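{- If there exists an STS$(u)$ with a 1-overlap cycle and an STS$(v)$ with a 1-overlap cycle, then there exists an STS$(uv)$ with a 1-overlap cycle.
   Context: A Steiner triple system of order $v$, STS$(v)$, is a pair $(X,\mathcal{B})$ with $|X|=v$ and $\mathcal{B}$ a set of 3-element subsets (blocks) of $X$ such that every pair of distinct points of $X$ lies in exactly one block. A 1-overlap cycle (1-ocycle) is a cyclic ordering $B_1,\dots,B_m$ of all blocks, each appearing exactly once and written as an ordered triple of its points, such that the last point of $B_i$ equals the first point of $B_{i+1}$ for all $i$ (indices modulo $m$). -}

module Defs where

open import Data.Nat using (ℕ)
open import Data.Fin using (Fin)
open import Data.Fin.Subset using (Subset; ∣_∣; ⁅_⁆; _∪_)
open import Data.Fin.Subset.Properties using (_∈?_)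
open import Data.Product using (_×_; _,_; Σ-syntax)
open import Data.List using (List; []; _∷_; length; filter; map)
open import Data.List.Membership.Propositional using (_∈_)
open import Data.List.Relation.Unary.Unique.Propositional using (Unique)
open import Data.List.Relation.Binary.Permutation.Propositional using (_↭_)
open import Relation.Binary.PropositionalEquality using (_≡_; _≢_)
open import Relation.Nullary.Decidable using (_×-dec_)

IsBlock : {v : ℕ} → Subset v → Set
IsBlock b = ∣ b ∣ ≡ 3

countPair : {v : ℕ} → List (Subset v) → Fin v → Fin v → ℕ
countPair B x y = length (filter (λ b → (x ∈? b) ×-dec (y ∈? b)) B)

-- (X , B) with X = Fin v is an STS(v): B is a set (duplicate-free list)
-- of 3-subsets and every pair of distinct points lies in exactly one block.
IsSTS : (v : ℕ) → List (Subset v) → Set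
IsSTS v B =
  Unique B
  × (∀ b → b ∈ B → IsBlock b)
  × (∀ (x y : Fin v) → x ≢ y → countPair B x y ≡ 1)

-- A block written as an ordered triple of its points.
Triple : ℕ → Set
Triple v = Fin v × Fin v × Fin v

toSet : {v : ℕ} → Triple v → Subset v
toSet (a , b , c) = ⁅ a ⁆ ∪ ⁅ b ⁆ ∪ ⁅ c ⁆

firstPt : {v : ℕ} → Triple v → Fin v
firstPt (a , _ , _) = a

lastPt : {v : ℕ} → Triple v → Fin v
lastPt (_ , _ , c) = c

CycLinked : {v : ℕ} → Fin v → List (Triple v) → Set
CycLinked h []            = Data.Unit.⊤ where import Data.Unit
CycLinked h (t ∷ [])      = lastPt t ≡ h
CycLinked h (t ∷ u ∷ ts)  = (lastPt t ≡ firstPt u) × CycLinked h (u ∷ ts)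

-- A 1-overlap cycle of the block set B: a cyclic ordering B_1,...,B_m of all
-- blocks, each exactly once (the underlying sets form a permutation of B),
-- each written as an ordered triple of its points, with last(B_i) = first(B_{i+1})
-- cyclically.
IsOneOCycle : {v : ℕ} → List (Subset v) → List (Triple v) → Set
IsOneOCycle B []       = B ≡ []
IsOneOCycle B (t ∷ ts) = (map toSet (t ∷ ts) ↭ B) × CycLinked (firstPt t) (t ∷ ts)

HasSTSWithOCycle : ℕ → Set
HasSTSWithOCycle v =
  Σ[ B ∈ List (Subset v) ] (IsSTS v B × Σ[ C ∈ List (Triple v) ] IsOneOCycle B C)

module Submission where

-- Points of the product system are pairs (x , y) of X × Y, and its blocks are
-- the classical product STS: the "vertical" lines {x} × s (s a block of Y),
-- the "horizontal" lines t × {y} (t a block of X), and, for every pair of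
-- blocks t , s, the six transversals of the 3 × 3 grid t × s.  Fix base
-- points x₀ , y₀ at which the given cycles C_X , C_Y start.  The new cycle is
--   (vertical lines {x₀} × s, s along C_Y),
--   then for each t along C_X: the horizontal line t × {y₀}, followed by one
--   "gadget" per s along C_Y,
-- where the gadget of (t , s) is a chain of ordered triples inside t × s made
-- of the six transversals together with the lines {a} × s (a ∈ t, a ≠ x₀,
-- when x₀ ∈ t) and t × {b} (b ∈ s, b ≠ y₀, when y₀ ∈ s).  A line {a} × s with
-- a ≠ x₀ is thus produced exactly once, by the unique block t ∋ a , x₀.
-- There are 16 gadgets, one for each way x₀ and y₀ can sit in t and s.
--
-- The local counts of the gadgets then become finitely many
-- decidable facts, settled by evaluation.  Summing them over the cycle shows
-- every pair of points is covered exactly once; chaining and the block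
-- conditions are checked gadget-wise.

open import Defs
open import Data.Nat using (ℕ; zero; suc; _+_; _*_; _≤_; s≤s; z≤n) renaming (_≟_ to _≟ℕ_)
open import Data.Nat.Properties using (*-zeroʳ; *-identityʳ; +-identityʳ; *-distribˡ-+; ≤-trans; ≤-reflexive; n≤1+n)
open import Data.Nat.ListAction using (sum)
open import Data.Nat.ListAction.Properties using (sum-++)
open import Data.Bool using (if_then_else_)
open import Data.Empty using (⊥-elim)
open import Data.Unit using (⊤; tt)
open import Data.Fin using (Fin; zero; suc; combine; remQuot)
open import Data.Fin.Properties using (all?; any?; combine-injectiveˡ; combine-injectiveʳ; combine-remQuot) renaming (_≟_ to _≟F_)
open import Data.Fin.Subset using (Subset; ∣_∣; ⁅_⁆; _∪_; inside; outside) renaming (_∈_ to _∈ˢ_; _∉_ to _∉ˢ_)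
open import Data.Fin.Subset.Properties using (_∈?_; x∈⁅x⁆; x∈⁅y⁆⇒x≡y; x∈p∪q⁻; x∈p∪q⁺; ∣⁅x⁆∣≡1; ∪-identityˡ)
open import Data.Maybe using (Maybe; just; nothing)
import Data.Maybe.Properties as Maybe
open import Data.Product using (_×_; _,_; proj₁; proj₂; ∃-syntax)
import Data.Product as Product
open import Data.Product.Properties using (,-injectiveˡ; ,-injectiveʳ) renaming (≡-dec to ≡-dec×)
open import Data.Sum using (_⊎_; inj₁; inj₂; [_,_])
import Data.Sum as Sum
open import Data.List using (List; []; _∷_; _++_; map; concatMap; length; filter)
open import Data.List.Properties using (map-++; map-cong; map-cong-local; map-∘; map-id; filter-accept; filter-reject)
open import Data.List.Relation.Unary.All using (All; []; _∷_; tabulate; lookup)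
import Data.List.Relation.Unary.All as All
import Data.List.Relation.Unary.All.Properties as All
open import Data.List.Relation.Unary.AllPairs using ([]; _∷_)
open import Data.List.Relation.Unary.Any using (here; there)
open import Data.List.Relation.Unary.Unique.Propositional using (Unique)
open import Data.List.Membership.Propositional using (_∈_)
open import Data.List.Membership.Propositional.Properties using (∈-map⁺; ∈-map⁻)
open import Data.List.Relation.Binary.Permutation.Propositional using (_↭_; ↭-refl)
open import Data.List.Relation.Binary.Permutation.Propositional.Properties using (∈-resp-↭; filter-↭; ↭-length)
open import Data.Vec using (_∷_)
open import Data.Vec.Base using (here; there)
open import Function using (_∘_; id)
open import Function.Bundles using (_⇔_; mk⇔; Equivalence)
open import Function.Definitions using (Injective)
open import Relation.Nullary using (Dec; yes; no; does; ¬_)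
open import Relation.Nullary.Decidable using (_×-dec_; _⊎-dec_; ¬?; _→-dec_; toWitness)
open import Relation.Binary.Definitions using (DecidableEquality)
open import Relation.Binary.PropositionalEquality using (_≡_; _≢_; refl; sym; trans; cong; cong₂; subst; module ≡-Reasoning)

open Equivalence using (to; from)

Inj : {A B : Set} → (A → B) → Set
Inj = Injective _≡_ _≡_

𝟙 : ∀ {p} {P : Set p} → Dec P → ℕ
𝟙 d = if does d then 1 else 0

𝟙-cong : ∀ {p q} {P : Set p} {Q : Set q} → P ⇔ Q → (a : Dec P) (b : Dec Q) → 𝟙 a ≡ 𝟙 b
𝟙-cong e (yes a) (yes b) = refl
𝟙-cong e (yes a) (no ¬b) = ⊥-elim (¬b (to e a))
𝟙-cong e (no ¬a) (yes b) = ⊥-elim (¬a (from e b))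
𝟙-cong e (no ¬a) (no ¬b) = refl

𝟙-× : ∀ {p q} {P : Set p} {Q : Set q} (a : Dec P) (b : Dec Q) → 𝟙 (a ×-dec b) ≡ 𝟙 a * 𝟙 b
𝟙-× (yes a) (yes b) = refl
𝟙-× (yes a) (no ¬b) = refl
𝟙-× (no ¬a) (yes b) = refl
𝟙-× (no ¬a) (no ¬b) = refl

𝟙-yes : ∀ {p} {P : Set p} (a : Dec P) → P → 𝟙 a ≡ 1
𝟙-yes (yes _) _ = refl
𝟙-yes (no ¬a) a = ⊥-elim (¬a a)

𝟙-no : ∀ {p} {P : Set p} (a : Dec P) → ¬ P → 𝟙 a ≡ 0
𝟙-no (yes a) ¬a = ⊥-elim (¬a a)
𝟙-no (no _) _ = refl

sumOf : {A : Set} → (A → ℕ) → List A → ℕ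
sumOf f xs = sum (map f xs)

sumOf-++ : {A : Set} (f : A → ℕ) (xs ys : List A) → sumOf f (xs ++ ys) ≡ sumOf f xs + sumOf f ys
sumOf-++ f xs ys = trans (cong sum (map-++ f xs ys)) (sum-++ (map f xs) (map f ys))

sumOf-concatMap : {A B : Set} (f : B → ℕ) (g : A → List B) (xs : List A) →
  sumOf f (concatMap g xs) ≡ sumOf (λ x → sumOf f (g x)) xs
sumOf-concatMap f g [] = refl
sumOf-concatMap f g (x ∷ xs) = trans (sumOf-++ f (g x) (concatMap g xs)) (cong (sumOf f (g x) +_) (sumOf-concatMap f g xs))

sumOf-map : {A B : Set} (f : B → ℕ) (g : A → B) (xs : List A) → sumOf f (map g xs) ≡ sumOf (f ∘ g) xs
sumOf-map f g xs = cong sum (sym (map-∘ xs))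

sumOf-cong : {A : Set} {f g : A → ℕ} → (∀ x → f x ≡ g x) → (xs : List A) → sumOf f xs ≡ sumOf g xs
sumOf-cong e xs = cong sum (map-cong e xs)

sumOf-congᴬ : {A : Set} {P : A → Set} {f g : A → ℕ} → (∀ x → P x → f x ≡ g x) → ∀ {xs} → All P xs → sumOf f xs ≡ sumOf g xs
sumOf-congᴬ e pxs = cong sum (map-cong-local (All.map (e _) pxs))

sumOf-*ˡ : {A : Set} (c : ℕ) (f : A → ℕ) (xs : List A) → sumOf (λ x → c * f x) xs ≡ c * sumOf f xs
sumOf-*ˡ c f [] = sym (*-zeroʳ c)
sumOf-*ˡ c f (x ∷ xs) = trans (cong (c * f x +_) (sumOf-*ˡ c f xs)) (sym (*-distribˡ-+ c (f x) _))

sumOf-zero : {A : Set} (xs : List A) → sumOf (λ _ → 0) xs ≡ 0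
sumOf-zero [] = refl
sumOf-zero (x ∷ xs) = sumOf-zero xs

sumOf-vanish : {A : Set} {P : A → Set} {f : A → ℕ} → (∀ x → P x → f x ≡ 0) → ∀ {xs} → All P xs → sumOf f xs ≡ 0
sumOf-vanish e {xs} pxs = trans (sumOf-congᴬ e pxs) (sumOf-zero xs)

length-filter : {A : Set} {P : A → Set} (P? : ∀ x → Dec (P x)) (xs : List A) → length (filter P? xs) ≡ sumOf (𝟙 ∘ P?) xs
length-filter P? [] = refl
length-filter P? (x ∷ xs) with P? x
... | yes _ = cong suc (length-filter P? xs)
... | no _ = length-filter P? xs

Tri : Set → Set
Tri A = A × A × A

first : {A : Set} → Tri A → A
first (a , _ , _) = a

last : {A : Set} → Tri A → A
last (_ , _ , c) = c

mapTri : {A B : Set} → (A → B) → Tri A → Tri B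
mapTri f (a , b , c) = (f a , f b , f c)

_∈ₜ_ : {A : Set} → A → Tri A → Set
x ∈ₜ (a , b , c) = x ≡ a ⊎ x ≡ b ⊎ x ≡ c

∈ₜ-transport : {C A B : Set} (φ : C → A) (ψ : C → B) {x : A} {x' : B} →
  (∀ p → x ≡ φ p → x' ≡ ψ p) → ∀ T → x ∈ₜ mapTri φ T → x' ∈ₜ mapTri ψ T
∈ₜ-transport φ ψ h (a , b , c) = Sum.map (h a) (Sum.map (h b) (h c))

Distinct : {A : Set} → Tri A → Set
Distinct (a , b , c) = (a ≢ b) × (a ≢ c) × (b ≢ c)

Distinct-map : {A B : Set} (f : A → B) → Inj f → ∀ t → Distinct t → Distinct (mapTri f t)
Distinct-map f inj (a , b , c) (d₁ , d₂ , d₃) = d₁ ∘ inj , d₂ ∘ inj , d₃ ∘ inj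

Chain : {A : Set} → A → A → List (Tri A) → Set
Chain s e [] = s ≡ e
Chain s e (t ∷ ts) = first t ≡ s × Chain (last t) e ts

Chain-++ : {A : Set} {s m e : A} (xs : List (Tri A)) {ys : List (Tri A)} → Chain s m xs → Chain m e ys → Chain s e (xs ++ ys)
Chain-++ [] refl q = q
Chain-++ (x ∷ xs) (h , p) q = h , Chain-++ xs p q

Chain-map : {A B : Set} (f : A → B) {s e : A} (xs : List (Tri A)) → Chain s e xs → Chain (f s) (f e) (map (mapTri f) xs)
Chain-map f [] p = cong f p
Chain-map f (x ∷ xs) (h , p) = cong f h , Chain-map f xs p

Chain-concatMap : {A B : Set} (g : A → B) (F : Tri A → List (Tri B)) →
  (∀ t → Chain (g (first t)) (g (last t)) (F t)) → ∀ {s e} (xs : List (Tri A)) → Chain s e xs → Chain (g s) (g e) (concatMap F xs)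
Chain-concatMap g F hF [] p = cong g p
Chain-concatMap g F hF (t ∷ ts) (refl , p) = Chain-++ (F t) (hF t) (Chain-concatMap g F hF ts p)

All-concatMap : {A B : Set} {P : A → Set} {Q : B → Set} (f : A → List B) →
  (∀ x → P x → All Q (f x)) → ∀ {xs} → All P xs → All Q (concatMap f xs)
All-concatMap f h pxs = All.concat⁺ (All.map⁺ (All.map (h _) pxs))

module DecTri {A : Set} (_≟_ : DecidableEquality A) where

  _∈ₜ?_ : ∀ x t → Dec (x ∈ₜ t)
  x ∈ₜ? (a , b , c) = (x ≟ a) ⊎-dec ((x ≟ b) ⊎-dec (x ≟ c))

  covers : A → A → Tri A → ℕ
  covers x y t = 𝟙 ((x ∈ₜ? t) ×-dec (y ∈ₜ? t))

  pairCount : A → A → List (Tri A) → ℕ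
  pairCount x y = sumOf (covers x y)

  chain? : ∀ s e xs → Dec (Chain s e xs)
  chain? s e [] = s ≟ e
  chain? s e (t ∷ ts) = (first t ≟ s) ×-dec chain? (last t) e ts

  distinct? : ∀ t → Dec (Distinct t)
  distinct? (a , b , c) = ¬? (a ≟ b) ×-dec (¬? (a ≟ c) ×-dec ¬? (b ≟ c))

open DecTri using (pairCount)

pairCount-reindex : {C A B : Set} (_≟A_ : DecidableEquality A) (_≟B_ : DecidableEquality B)
  (φ : C → A) (ψ : C → B) {x y : A} {x' y' : B} →
  (∀ p → (x ≡ φ p) ⇔ (x' ≡ ψ p)) → (∀ p → (y ≡ φ p) ⇔ (y' ≡ ψ p)) →
  (ts : List (Tri C)) → pairCount _≟A_ x y (map (mapTri φ) ts) ≡ pairCount _≟B_ x' y' (map (mapTri ψ) ts)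
pairCount-reindex _≟A_ _≟B_ φ ψ {x} {y} {x'} {y'} ex ey ts = begin
  sumOf (CA.covers x y) (map (mapTri φ) ts)    ≡⟨ sumOf-map _ (mapTri φ) ts ⟩
  sumOf (CA.covers x y ∘ mapTri φ) ts          ≡⟨ sumOf-cong coversEq ts ⟩
  sumOf (CB.covers x' y' ∘ mapTri ψ) ts        ≡⟨ sym (sumOf-map _ (mapTri ψ) ts) ⟩
  sumOf (CB.covers x' y') (map (mapTri ψ) ts)  ∎
  where
  open ≡-Reasoning
  module CA = DecTri _≟A_
  module CB = DecTri _≟B_
  coversEq : ∀ T → CA.covers x y (mapTri φ T) ≡ CB.covers x' y' (mapTri ψ T)
  coversEq T = 𝟙-cong
    (mk⇔ (Product.map (∈ₜ-transport φ ψ (to ∘ ex) T) (∈ₜ-transport φ ψ (to ∘ ey) T))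
         (Product.map (∈ₜ-transport ψ φ (from ∘ ex) T) (∈ₜ-transport ψ φ (from ∘ ey) T)))
    ((x CA.∈ₜ? mapTri φ T) ×-dec (y CA.∈ₜ? mapTri φ T)) ((x' CB.∈ₜ? mapTri ψ T) ×-dec (y' CB.∈ₜ? mapTri ψ T))

pairCount-injective : {A B : Set} (_≟A_ : DecidableEquality A) (_≟B_ : DecidableEquality B)
  (f : A → B) → Inj f → ∀ x y (ts : List (Tri A)) →
  pairCount _≟B_ (f x) (f y) (map (mapTri f) ts) ≡ pairCount _≟A_ x y ts
pairCount-injective _≟A_ _≟B_ f f-inj x y ts =
  trans (pairCount-reindex _≟B_ _≟A_ f id (λ p → mk⇔ f-inj (cong f)) (λ p → mk⇔ f-inj (cong f)) ts)
        (cong (pairCount _≟A_ x y) (trans (map-cong (λ _ → refl) ts) (map-id ts)))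

entry : {A : Set} → Tri A → Fin 3 → A
entry (a , b , c) zero = a
entry (a , b , c) (suc zero) = b
entry (a , b , c) (suc (suc zero)) = c

entry-injective : {A : Set} (t : Tri A) → Distinct t → Inj (entry t)
entry-injective t d {zero} {zero} e = refl
entry-injective t (d₁ , d₂ , d₃) {zero} {suc zero} e = ⊥-elim (d₁ e)
entry-injective t (d₁ , d₂ , d₃) {zero} {suc (suc zero)} e = ⊥-elim (d₂ e)
entry-injective t (d₁ , d₂ , d₃) {suc zero} {zero} e = ⊥-elim (d₁ (sym e))
entry-injective t d {suc zero} {suc zero} e = refl
entry-injective t (d₁ , d₂ , d₃) {suc zero} {suc (suc zero)} e = ⊥-elim (d₃ e)
entry-injective t (d₁ , d₂ , d₃) {suc (suc zero)} {zero} e = ⊥-elim (d₂ (sym e))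
entry-injective t (d₁ , d₂ , d₃) {suc (suc zero)} {suc zero} e = ⊥-elim (d₃ (sym e))
entry-injective t d {suc (suc zero)} {suc (suc zero)} e = refl

entry⇔∈ₜ : {A : Set} {x : A} (t : Tri A) → (∃[ i ] entry t i ≡ x) ⇔ (x ∈ₜ t)
entry⇔∈ₜ t = mk⇔ (λ { (zero , e) → inj₁ (sym e)
                    ; (suc zero , e) → inj₂ (inj₁ (sym e))
                    ; (suc (suc zero) , e) → inj₂ (inj₂ (sym e)) })
                 (λ { (inj₁ e) → zero , sym e
                    ; (inj₂ (inj₁ e)) → suc zero , sym e
                    ; (inj₂ (inj₂ e)) → suc (suc zero) , sym e })

single : {A : Set} → A → Fin 1 → A
single x _ = x

single-injective : {A : Set} (x : A) → Inj (single x)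
single-injective x {zero} {zero} _ = refl

occurs : {B : Set} → Maybe B → ℕ
occurs (just _) = 1
occurs nothing = 0

Apart : ∀ {m} → Maybe (Fin m) → Maybe (Fin m) → Set
Apart (just i) (just j) = i ≢ j
Apart _ _ = ⊤

apart? : ∀ {m} (a b : Maybe (Fin m)) → Dec (Apart a b)
apart? (just i) (just j) = ¬? (i ≟F j)
apart? (just i) nothing = yes tt
apart? nothing (just j) = yes tt
apart? nothing nothing = yes tt

module Position {A : Set} (_≟_ : DecidableEquality A) where

  position : ∀ {m} → (Fin m → A) → A → Maybe (Fin m)
  position f x with any? (λ i → f i ≟ x)
  ... | yes (i , _) = just i
  ... | no _ = nothing

  position-sound : ∀ {m} (f : Fin m → A) (x : A) {i : Fin m} → position f x ≡ just i → f i ≡ x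
  position-sound f x eq with any? (λ i → f i ≟ x)
  position-sound f x refl | yes (i , e) = e

  position-injective : ∀ {m} (f : Fin m → A) → Inj f → (x : A) (i : Fin m) → f i ≡ x → position f x ≡ just i
  position-injective f inj x i e with any? (λ i → f i ≟ x)
  ... | yes (j , e') = cong just (inj (trans e' (sym e)))
  ... | no ¬∃ = ⊥-elim (¬∃ (i , e))

  occurs-position : ∀ {m} (f : Fin m → A) (x : A) {q} {Q : Set q} (d : Dec Q) →
    (∃[ i ] f i ≡ x) ⇔ Q → occurs (position f x) ≡ 𝟙 d
  occurs-position f x d e with any? (λ i → f i ≟ x)
  ... | yes p = sym (𝟙-yes d (to e p))
  ... | no ¬p = sym (𝟙-no d (¬p ∘ from e))

  covers-occurs : (t : Tri A) (x y : A) →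
    DecTri.covers _≟_ x y t ≡ occurs (position (entry t) x) * occurs (position (entry t) y)
  covers-occurs t x y = trans (𝟙-× (x ∈ₜ? t) (y ∈ₜ? t))
    (sym (cong₂ _*_ (occurs-position (entry t) x (x ∈ₜ? t) (entry⇔∈ₜ t))
                    (occurs-position (entry t) y (y ∈ₜ? t) (entry⇔∈ₜ t))))
    where open DecTri _≟_ using (_∈ₜ?_)

  apart-position : ∀ {m} (f : Fin m → A) (x y : A) → x ≢ y → Apart (position f x) (position f y)
  apart-position f x y x≢y with position f x in ex | position f y in ey
  ... | nothing | nothing = tt
  ... | nothing | just _ = tt
  ... | just _ | nothing = tt
  ... | just i | just j = λ { refl → x≢y (trans (sym (position-sound f x ex)) (position-sound f y ey)) }

  occurs-apart-self : ∀ {m} (f : Fin m → A) (x : A) →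
    let a = position f x in occurs a * (𝟙 (apart? a a) * occurs a) ≡ 0
  occurs-apart-self f x with position f x
  ... | nothing = refl
  ... | just i with i ≟F i
  ... | yes _ = refl
  ... | no i≢i = ⊥-elim (i≢i refl)

  occurs-apart : ∀ {m} (f : Fin m → A) (x y : A) → x ≢ y →
    let a = position f x ; b = position f y in occurs a * (𝟙 (apart? a b) * occurs b) ≡ occurs a * occurs b
  occurs-apart f x y x≢y with position f x | position f y | apart-position f x y x≢y
  ... | nothing | _ | _ = refl
  ... | just i | nothing | _ = *-zeroʳ (𝟙 (apart? (just i) nothing))
  ... | just i | just j | i≢j = cong (λ k → k * 1 + 0) (𝟙-yes (¬? (i ≟F j)) i≢j)

-- Relative position of a point of a product with respect to a grid of
-- m × n cells: its position along each axis, if any.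
RelPos : ℕ → ℕ → Set
RelPos m n = Maybe (Fin m) × Maybe (Fin n)

_≟R_ : ∀ {m n} → DecidableEquality (RelPos m n)
_≟R_ = ≡-dec× (Maybe.≡-dec _≟F_) (Maybe.≡-dec _≟F_)

cell : ∀ {m n} → Fin m × Fin n → RelPos m n
cell (i , j) = (just i , just j)

cellCount : ∀ {m n} → RelPos m n → RelPos m n → List (Tri (Fin m × Fin n)) → ℕ
cellCount c d pat = pairCount _≟R_ c d (map (mapTri cell) pat)

module Grid {X Y : Set} (_≟X_ : DecidableEquality X) (_≟Y_ : DecidableEquality Y) where

  module PosX = Position _≟X_
  module PosY = Position _≟Y_

  _≟P_ : DecidableEquality (X × Y)
  _≟P_ = ≡-dec× _≟X_ _≟Y_

  plot : ∀ {m n} → (Fin m → X) → (Fin n → Y) → Fin m × Fin n → X × Y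
  plot f g (i , j) = (f i , g j)

  locate : ∀ {m n} → (Fin m → X) → (Fin n → Y) → X × Y → RelPos m n
  locate f g (x , y) = (PosX.position f x , PosY.position g y)

  module _ {m n} (f : Fin m → X) (g : Fin n → Y) (f-inj : Inj f) (g-inj : Inj g) where

    plot⇔locate : ∀ (P : X × Y) (p : Fin m × Fin n) → (P ≡ plot f g p) ⇔ (locate f g P ≡ cell p)
    plot⇔locate (x , y) (i , j) = mk⇔
      (λ e → cong₂ _,_ (PosX.position-injective f f-inj x i (sym (,-injectiveˡ e)))
                       (PosY.position-injective g g-inj y j (sym (,-injectiveʳ e))))
      (λ e → cong₂ _,_ (sym (PosX.position-sound f x (,-injectiveˡ e)))
                       (sym (PosY.position-sound g y (,-injectiveʳ e))))

    plot-injective : Inj (plot f g)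
    plot-injective e = cong₂ _,_ (f-inj (,-injectiveˡ e)) (g-inj (,-injectiveʳ e))

    pairCount-plot : ∀ (P Q : X × Y) (pat : List (Tri (Fin m × Fin n))) →
      pairCount _≟P_ P Q (map (mapTri (plot f g)) pat) ≡ cellCount (locate f g P) (locate f g Q) pat
    pairCount-plot P Q = pairCount-reindex _≟P_ _≟R_ (plot f g) cell (plot⇔locate P) (plot⇔locate Q)

    plot-distinct : ∀ (pat : List (Tri (Fin m × Fin n))) → All Distinct pat → All Distinct (map (mapTri (plot f g)) pat)
    plot-distinct pat d = All.map⁺ (All.map (λ {T} → Distinct-map (plot f g) plot-injective T) d)

pattern p0 = zero
pattern p1 = suc zero
pattern p2 = suc (suc zero)
pattern c00 = (p0 , p0)
pattern c01 = (p0 , p1)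
pattern c02 = (p0 , p2)
pattern c10 = (p1 , p0)
pattern c11 = (p1 , p1)
pattern c12 = (p1 , p2)
pattern c20 = (p2 , p0)
pattern c21 = (p2 , p1)
pattern c22 = (p2 , p2)

-- The gadget for a pair of blocks t , s, given the positions of the base
-- points x₀ in t and y₀ in s (nothing when absent).  It consists of the six
-- transversals of t × s, the columns {t i} × s for t i ≠ x₀ when x₀ ∈ t, and
-- the rows t × {s j} for s j ≠ y₀ when y₀ ∈ s, chained from c20 to c22.
gadget : Maybe (Fin 3) → Maybe (Fin 3) → List (Tri (Fin 3 × Fin 3))
gadget (just p0) (just p0) = (c20 , c01 , c12) ∷ (c12 , c00 , c21) ∷ (c21 , c02 , c10) ∷ (c10 , c01 , c22) ∷ (c22 , c00 , c11) ∷ (c11 , c02 , c20) ∷ (c20 , c22 , c21) ∷ (c21 , c01 , c11) ∷ (c11 , c10 , c12) ∷ (c12 , c02 , c22) ∷ []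
gadget (just p0) (just p1) = (c20 , c01 , c12) ∷ (c12 , c00 , c21) ∷ (c21 , c02 , c10) ∷ (c10 , c01 , c22) ∷ (c22 , c00 , c11) ∷ (c11 , c20 , c02) ∷ (c02 , c22 , c12) ∷ (c12 , c11 , c10) ∷ (c10 , c00 , c20) ∷ (c20 , c21 , c22) ∷ []
gadget (just p0) (just p2) = (c20 , c01 , c12) ∷ (c12 , c00 , c21) ∷ (c21 , c02 , c10) ∷ (c10 , c01 , c22) ∷ (c22 , c00 , c11) ∷ (c11 , c02 , c20) ∷ (c20 , c00 , c10) ∷ (c10 , c12 , c11) ∷ (c11 , c01 , c21) ∷ (c21 , c20 , c22) ∷ []
gadget (just p0) nothing = (c20 , c01 , c12) ∷ (c12 , c00 , c21) ∷ (c21 , c10 , c02) ∷ (c02 , c11 , c20) ∷ (c20 , c21 , c22) ∷ (c22 , c00 , c11) ∷ (c11 , c12 , c10) ∷ (c10 , c01 , c22) ∷ []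
gadget (just p1) (just p0) = (c20 , c01 , c12) ∷ (c12 , c00 , c21) ∷ (c21 , c02 , c10) ∷ (c10 , c01 , c22) ∷ (c22 , c00 , c11) ∷ (c11 , c02 , c20) ∷ (c20 , c22 , c21) ∷ (c21 , c11 , c01) ∷ (c01 , c00 , c02) ∷ (c02 , c12 , c22) ∷ []
gadget (just p1) (just p1) = (c20 , c01 , c12) ∷ (c12 , c00 , c21) ∷ (c21 , c02 , c10) ∷ (c10 , c22 , c01) ∷ (c01 , c02 , c00) ∷ (c00 , c10 , c20) ∷ (c20 , c21 , c22) ∷ (c22 , c00 , c11) ∷ (c11 , c20 , c02) ∷ (c02 , c12 , c22) ∷ []
gadget (just p1) (just p2) = (c20 , c01 , c12) ∷ (c12 , c00 , c21) ∷ (c21 , c02 , c10) ∷ (c10 , c01 , c22) ∷ (c22 , c00 , c11) ∷ (c11 , c02 , c20) ∷ (c20 , c10 , c00) ∷ (c00 , c02 , c01) ∷ (c01 , c11 , c21) ∷ (c21 , c20 , c22) ∷ []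
gadget (just p1) nothing = (c20 , c01 , c12) ∷ (c12 , c00 , c21) ∷ (c21 , c02 , c10) ∷ (c10 , c01 , c22) ∷ (c22 , c11 , c00) ∷ (c00 , c01 , c02) ∷ (c02 , c11 , c20) ∷ (c20 , c21 , c22) ∷ []
gadget (just p2) (just p0) = (c20 , c01 , c12) ∷ (c12 , c00 , c21) ∷ (c21 , c02 , c10) ∷ (c10 , c01 , c22) ∷ (c22 , c00 , c11) ∷ (c11 , c20 , c02) ∷ (c02 , c00 , c01) ∷ (c01 , c21 , c11) ∷ (c11 , c10 , c12) ∷ (c12 , c02 , c22) ∷ []
gadget (just p2) (just p1) = (c20 , c01 , c12) ∷ (c12 , c00 , c21) ∷ (c21 , c02 , c10) ∷ (c10 , c01 , c22) ∷ (c22 , c00 , c11) ∷ (c11 , c20 , c02) ∷ (c02 , c01 , c00) ∷ (c00 , c20 , c10) ∷ (c10 , c11 , c12) ∷ (c12 , c02 , c22) ∷ []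
gadget (just p2) (just p2) = (c20 , c01 , c12) ∷ (c12 , c00 , c21) ∷ (c21 , c02 , c10) ∷ (c10 , c22 , c01) ∷ (c01 , c21 , c11) ∷ (c11 , c20 , c02) ∷ (c02 , c01 , c00) ∷ (c00 , c20 , c10) ∷ (c10 , c12 , c11) ∷ (c11 , c00 , c22) ∷ []
gadget (just p2) nothing = (c20 , c01 , c12) ∷ (c12 , c00 , c21) ∷ (c21 , c10 , c02) ∷ (c02 , c20 , c11) ∷ (c11 , c12 , c10) ∷ (c10 , c22 , c01) ∷ (c01 , c02 , c00) ∷ (c00 , c11 , c22) ∷ []
gadget nothing (just p0) = (c20 , c01 , c12) ∷ (c12 , c21 , c00) ∷ (c00 , c11 , c22) ∷ (c22 , c01 , c10) ∷ (c10 , c02 , c21) ∷ (c21 , c01 , c11) ∷ (c11 , c20 , c02) ∷ (c02 , c12 , c22) ∷ []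
gadget nothing (just p1) = (c20 , c01 , c12) ∷ (c12 , c00 , c21) ∷ (c21 , c02 , c10) ∷ (c10 , c01 , c22) ∷ (c22 , c11 , c00) ∷ (c00 , c10 , c20) ∷ (c20 , c11 , c02) ∷ (c02 , c12 , c22) ∷ []
gadget nothing (just p2) = (c20 , c01 , c12) ∷ (c12 , c00 , c21) ∷ (c21 , c02 , c10) ∷ (c10 , c22 , c01) ∷ (c01 , c21 , c11) ∷ (c11 , c02 , c20) ∷ (c20 , c10 , c00) ∷ (c00 , c11 , c22) ∷ []
gadget nothing nothing = (c20 , c01 , c12) ∷ (c12 , c21 , c00) ∷ (c00 , c22 , c11) ∷ (c11 , c20 , c02) ∷ (c02 , c21 , c10) ∷ (c10 , c01 , c22) ∷ []

-- The line t × {y₀} and the line {x₀} × s, as patterns on 3 × 1 and 1 × 3 grids.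
horizontalLine : List (Tri (Fin 3 × Fin 1))
horizontalLine = ((p0 , p0) , (p1 , p0) , (p2 , p0)) ∷ []

verticalLine : List (Tri (Fin 1 × Fin 3))
verticalLine = ((p0 , p0) , (p0 , p1) , (p0 , p2)) ∷ []

all-maybe? : ∀ {k p} {P : Maybe (Fin k) → Set p} → (∀ c → Dec (P c)) → Dec (∀ c → P c)
all-maybe? P? with P? nothing | all? (λ i → P? (just i))
... | yes pn | yes pj = yes (λ { nothing → pn ; (just i) → pj i })
... | no ¬pn | _ = no (λ h → ¬pn (h nothing))
... | yes _ | no ¬pj = no (λ h → ¬pj (λ i → h (just i)))

-- Local pair counts of the patterns, verified by evaluation over all relative
-- positions.  A pair is "vertical" if the points share their X-coordinate,
-- "horizontal" if they share the Y-coordinate, and "diagonal" otherwise;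
-- distinct coordinates have apart positions.  For instance a vertical pair
-- lies in the gadget iff both points are in the grid and in a column
-- {t i} × s produced by the gadget, i.e. with t i and x₀ both in t and apart.
gadget-vertical : ∀ hx hy cx cPy cQy → Apart cPy cQy →
  cellCount (cx , cPy) (cx , cQy) (gadget hx hy) ≡ occurs cx * (𝟙 (apart? cx hx) * occurs hx) * (occurs cPy * occurs cQy)
gadget-vertical = toWitness {a? = all-maybe? λ hx → all-maybe? λ hy → all-maybe? λ cx → all-maybe? λ cPy → all-maybe? λ cQy →
  apart? cPy cQy →-dec (cellCount (cx , cPy) (cx , cQy) (gadget hx hy) ≟ℕ occurs cx * (𝟙 (apart? cx hx) * occurs hx) * (occurs cPy * occurs cQy))} tt

gadget-horizontal : ∀ hx hy cPx cQx cy → Apart cPx cQx →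
  cellCount (cPx , cy) (cQx , cy) (gadget hx hy) ≡ (occurs cPx * occurs cQx) * (occurs cy * (𝟙 (apart? cy hy) * occurs hy))
gadget-horizontal = toWitness {a? = all-maybe? λ hx → all-maybe? λ hy → all-maybe? λ cPx → all-maybe? λ cQx → all-maybe? λ cy →
  apart? cPx cQx →-dec (cellCount (cPx , cy) (cQx , cy) (gadget hx hy) ≟ℕ (occurs cPx * occurs cQx) * (occurs cy * (𝟙 (apart? cy hy) * occurs hy)))} tt

gadget-diagonal : ∀ hx hy cPx cQx cPy cQy → Apart cPx cQx → Apart cPy cQy →
  cellCount (cPx , cPy) (cQx , cQy) (gadget hx hy) ≡ (occurs cPx * occurs cQx) * (occurs cPy * occurs cQy)
gadget-diagonal = toWitness {a? = all-maybe? λ hx → all-maybe? λ hy → all-maybe? λ cPx → all-maybe? λ cQx → all-maybe? λ cPy → all-maybe? λ cQy →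
  apart? cPx cQx →-dec (apart? cPy cQy →-dec (cellCount (cPx , cPy) (cQx , cQy) (gadget hx hy) ≟ℕ (occurs cPx * occurs cQx) * (occurs cPy * occurs cQy)))} tt

horizontalLine-vertical : ∀ cx cPy cQy → Apart cPy cQy → cellCount (cx , cPy) (cx , cQy) horizontalLine ≡ 0
horizontalLine-vertical = toWitness {a? = all-maybe? λ cx → all-maybe? λ cPy → all-maybe? λ cQy →
  apart? cPy cQy →-dec (cellCount (cx , cPy) (cx , cQy) horizontalLine ≟ℕ 0)} tt

horizontalLine-horizontal : ∀ cPx cQx cy → Apart cPx cQx →
  cellCount (cPx , cy) (cQx , cy) horizontalLine ≡ (occurs cPx * occurs cQx) * occurs cy
horizontalLine-horizontal = toWitness {a? = all-maybe? λ cPx → all-maybe? λ cQx → all-maybe? λ cy →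
  apart? cPx cQx →-dec (cellCount (cPx , cy) (cQx , cy) horizontalLine ≟ℕ (occurs cPx * occurs cQx) * occurs cy)} tt

horizontalLine-diagonal : ∀ cPx cQx cPy cQy → Apart cPx cQx → Apart cPy cQy → cellCount (cPx , cPy) (cQx , cQy) horizontalLine ≡ 0
horizontalLine-diagonal = toWitness {a? = all-maybe? λ cPx → all-maybe? λ cQx → all-maybe? λ cPy → all-maybe? λ cQy →
  apart? cPx cQx →-dec (apart? cPy cQy →-dec (cellCount (cPx , cPy) (cQx , cQy) horizontalLine ≟ℕ 0))} tt

verticalLine-vertical : ∀ cx cPy cQy → Apart cPy cQy →
  cellCount (cx , cPy) (cx , cQy) verticalLine ≡ occurs cx * (occurs cPy * occurs cQy)
verticalLine-vertical = toWitness {a? = all-maybe? λ cx → all-maybe? λ cPy → all-maybe? λ cQy →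
  apart? cPy cQy →-dec (cellCount (cx , cPy) (cx , cQy) verticalLine ≟ℕ occurs cx * (occurs cPy * occurs cQy))} tt

verticalLine-horizontal : ∀ cPx cQx cy → Apart cPx cQx → cellCount (cPx , cy) (cQx , cy) verticalLine ≡ 0
verticalLine-horizontal = toWitness {a? = all-maybe? λ cPx → all-maybe? λ cQx → all-maybe? λ cy →
  apart? cPx cQx →-dec (cellCount (cPx , cy) (cQx , cy) verticalLine ≟ℕ 0)} tt

verticalLine-diagonal : ∀ cPx cQx cPy cQy → Apart cPx cQx → Apart cPy cQy → cellCount (cPx , cPy) (cQx , cQy) verticalLine ≡ 0
verticalLine-diagonal = toWitness {a? = all-maybe? λ cPx → all-maybe? λ cQx → all-maybe? λ cPy → all-maybe? λ cQy →
  apart? cPx cQx →-dec (apart? cPy cQy →-dec (cellCount (cPx , cPy) (cQx , cQy) verticalLine ≟ℕ 0))} tt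

gadget-chain : ∀ hx hy → Chain c20 c22 (gadget hx hy)
gadget-chain = toWitness {a? = all-maybe? λ hx → all-maybe? λ hy → DecTri.chain? (≡-dec× _≟F_ _≟F_) c20 c22 (gadget hx hy)} tt

gadget-distinct : ∀ hx hy → All Distinct (gadget hx hy)
gadget-distinct = toWitness {a? = all-maybe? λ hx → all-maybe? λ hy → All.all? (DecTri.distinct? (≡-dec× _≟F_ _≟F_)) (gadget hx hy)} tt

horizontalLine-distinct : All Distinct horizontalLine
horizontalLine-distinct = ((λ ()) , (λ ()) , (λ ())) ∷ []

verticalLine-distinct : All Distinct verticalLine
verticalLine-distinct = ((λ ()) , (λ ()) , (λ ())) ∷ []

module ProductCycle {X Y : Set} (_≟X_ : DecidableEquality X) (_≟Y_ : DecidableEquality Y)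
  (CX : List (Tri X)) (CY : List (Tri Y)) (x₀ : X) (y₀ : Y)
  (CX-distinct : All Distinct CX) (CY-distinct : All Distinct CY)
  (CX-pairs : ∀ x x' → x ≢ x' → pairCount _≟X_ x x' CX ≡ 1)
  (CY-pairs : ∀ y y' → y ≢ y' → pairCount _≟Y_ y y' CY ≡ 1)
  (CX-chain : Chain x₀ x₀ CX) (CY-chain : Chain y₀ y₀ CY) where

  open Grid _≟X_ _≟Y_
  open ≡-Reasoning

  posX : Tri X → X → Maybe (Fin 3)
  posX t = PosX.position (entry t)

  posY : Tri Y → Y → Maybe (Fin 3)
  posY s = PosY.position (entry s)

  verticalAt : Tri Y → List (Tri (X × Y))
  verticalAt s = map (mapTri (plot (single x₀) (entry s))) verticalLine

  horizontalAt : Tri X → List (Tri (X × Y))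
  horizontalAt t = map (mapTri (plot (entry t) (single y₀))) horizontalLine

  gadgetAt : Tri X → Tri Y → List (Tri (X × Y))
  gadgetAt t s = map (mapTri (plot (entry t) (entry s))) (gadget (posX t x₀) (posY s y₀))

  segment : Tri X → List (Tri (X × Y))
  segment t = horizontalAt t ++ concatMap (gadgetAt t) CY

  cycle : List (Tri (X × Y))
  cycle = concatMap verticalAt CY ++ concatMap segment CX

  -- Each piece runs along the grid of its blocks, so the pieces link up as
  -- the given cycles do.
  cycle-chain : Chain (x₀ , y₀) (x₀ , y₀) cycle
  cycle-chain = Chain-++ (concatMap verticalAt CY)
      (Chain-concatMap (x₀ ,_) verticalAt
        (λ s → Chain-map (plot (single x₀) (entry s)) verticalLine (refl , refl)) CY CY-chain)
      (Chain-concatMap (_, y₀) segment segment-chain CX CX-chain)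
    where
    segment-chain : ∀ t → Chain (first t , y₀) (last t , y₀) (segment t)
    segment-chain t = Chain-++ (horizontalAt t)
      (Chain-map (plot (entry t) (single y₀)) horizontalLine (refl , refl))
      (Chain-concatMap (last t ,_) (gadgetAt t)
        (λ s → Chain-map (plot (entry t) (entry s)) _ (gadget-chain _ _)) CY CY-chain)

  -- Plotting along injective enumerations keeps the entries distinct.
  cycle-distinct : All Distinct cycle
  cycle-distinct = All.++⁺
    (All-concatMap verticalAt (λ s ds → plot-distinct (single x₀) (entry s) (single-injective x₀) (entry-injective s ds) verticalLine verticalLine-distinct) CY-distinct)
    (All-concatMap segment (λ t dt → All.++⁺
       (plot-distinct (entry t) (single y₀) (entry-injective t dt) (single-injective y₀) horizontalLine horizontalLine-distinct)
       (All-concatMap (gadgetAt t) (λ s ds → plot-distinct (entry t) (entry s) (entry-injective t dt) (entry-injective s ds) _ (gadget-distinct _ _)) CY-distinct))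
     CX-distinct)

  count : X × Y → X × Y → List (Tri (X × Y)) → ℕ
  count = pairCount _≟P_

  count-cycle : ∀ P Q → count P Q cycle ≡
    sumOf (λ s → count P Q (verticalAt s)) CY + sumOf (λ t → count P Q (horizontalAt t) + sumOf (λ s → count P Q (gadgetAt t s)) CY) CX
  count-cycle P Q = begin
    count P Q cycle
      ≡⟨ sumOf-++ covers (concatMap verticalAt CY) (concatMap segment CX) ⟩
    count P Q (concatMap verticalAt CY) + count P Q (concatMap segment CX)
      ≡⟨ cong₂ _+_ (sumOf-concatMap covers verticalAt CY) (sumOf-concatMap covers segment CX) ⟩
    sumOf (λ s → count P Q (verticalAt s)) CY + sumOf (λ t → count P Q (segment t)) CX
      ≡⟨ cong (sumOf (λ s → count P Q (verticalAt s)) CY +_) (sumOf-cong segment-count CX) ⟩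
    sumOf (λ s → count P Q (verticalAt s)) CY + sumOf (λ t → count P Q (horizontalAt t) + sumOf (λ s → count P Q (gadgetAt t s)) CY) CX ∎
    where
    covers : Tri (X × Y) → ℕ
    covers = DecTri.covers _≟P_ P Q
    segment-count : ∀ t → count P Q (segment t) ≡ count P Q (horizontalAt t) + sumOf (λ s → count P Q (gadgetAt t s)) CY
    segment-count t = trans (sumOf-++ covers (horizontalAt t) (concatMap (gadgetAt t) CY))
                            (cong (count P Q (horizontalAt t) +_) (sumOf-concatMap covers (gadgetAt t) CY))

  count-vertical : ∀ s → Distinct s → ∀ P Q →
    count P Q (verticalAt s) ≡ cellCount (locate (single x₀) (entry s) P) (locate (single x₀) (entry s) Q) verticalLine
  count-vertical s ds P Q = pairCount-plot (single x₀) (entry s) (single-injective x₀) (entry-injective s ds) P Q verticalLine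

  count-horizontal : ∀ t → Distinct t → ∀ P Q →
    count P Q (horizontalAt t) ≡ cellCount (locate (entry t) (single y₀) P) (locate (entry t) (single y₀) Q) horizontalLine
  count-horizontal t dt P Q = pairCount-plot (entry t) (single y₀) (entry-injective t dt) (single-injective y₀) P Q horizontalLine

  count-gadget : ∀ t → Distinct t → ∀ s → Distinct s → ∀ P Q →
    count P Q (gadgetAt t s) ≡ cellCount (locate (entry t) (entry s) P) (locate (entry t) (entry s) Q) (gadget (posX t x₀) (posY s y₀))
  count-gadget t dt s ds P Q = pairCount-plot (entry t) (entry s) (entry-injective t dt) (entry-injective s ds) P Q (gadget (posX t x₀) (posY s y₀))

  baseX : X → Maybe (Fin 1)
  baseX = PosX.position (single x₀)

  baseY : Y → Maybe (Fin 1)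
  baseY = PosY.position (single y₀)

  occurs-baseX : ∀ x → occurs (baseX x) ≡ 𝟙 (x₀ ≟X x)
  occurs-baseX x = PosX.occurs-position (single x₀) x (x₀ ≟X x) (mk⇔ proj₂ (zero ,_))

  occurs-baseY : ∀ y → occurs (baseY y) ≡ 𝟙 (y₀ ≟Y y)
  occurs-baseY y = PosY.occurs-position (single y₀) y (y₀ ≟Y y) (mk⇔ proj₂ (zero ,_))

  -- Two distinct points lie in exactly one block; so a weight c spread over
  -- the blocks through both points sums to c.
  pairsX : ∀ x x' → x ≢ x' → sumOf (λ t → occurs (posX t x) * occurs (posX t x')) CX ≡ 1
  pairsX x x' x≢x' = trans (sumOf-cong (λ t → sym (PosX.covers-occurs t x x')) CX) (CX-pairs x x' x≢x')

  pairsY : ∀ y y' → y ≢ y' → sumOf (λ s → occurs (posY s y) * occurs (posY s y')) CY ≡ 1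
  pairsY y y' y≢y' = trans (sumOf-cong (λ s → sym (PosY.covers-occurs s y y')) CY) (CY-pairs y y' y≢y')

  blocksThroughY : ∀ c y y' → y ≢ y' → sumOf (λ s → c * (occurs (posY s y) * occurs (posY s y'))) CY ≡ c
  blocksThroughY c y y' y≢y' = begin
    sumOf (λ s → c * (occurs (posY s y) * occurs (posY s y'))) CY ≡⟨ sumOf-*ˡ c _ CY ⟩
    c * sumOf (λ s → occurs (posY s y) * occurs (posY s y')) CY ≡⟨ cong (c *_) (pairsY y y' y≢y') ⟩
    c * 1                                                         ≡⟨ *-identityʳ c ⟩
    c ∎

  -- columnWeight x t = 1 iff the gadgets of t produce the lines {x} × s,
  -- i.e. x and x₀ are distinct points of t.  Together with the lines at x₀,
  -- every column is produced once.
  columnWeight : X → Tri X → ℕ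
  columnWeight x t = occurs (posX t x) * (𝟙 (apart? (posX t x) (posX t x₀)) * occurs (posX t x₀))

  columnsThrough : ∀ x → 𝟙 (x₀ ≟X x) + sumOf (columnWeight x) CX ≡ 1
  columnsThrough x with x₀ ≟X x
  ... | yes refl = cong suc (sumOf-vanish (λ t _ → PosX.occurs-apart-self (entry t) x₀) CX-distinct)
  ... | no x₀≢x = trans (sumOf-cong (λ t → PosX.occurs-apart (entry t) x x₀ (x₀≢x ∘ sym)) CX)
                        (pairsX x x₀ (x₀≢x ∘ sym))

  rowWeight : Y → Tri Y → ℕ
  rowWeight y s = occurs (posY s y) * (𝟙 (apart? (posY s y) (posY s y₀)) * occurs (posY s y₀))

  rowsThrough : ∀ y → 𝟙 (y₀ ≟Y y) + sumOf (rowWeight y) CY ≡ 1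
  rowsThrough y with y₀ ≟Y y
  ... | yes refl = cong suc (sumOf-vanish (λ s _ → PosY.occurs-apart-self (entry s) y₀) CY-distinct)
  ... | no y₀≢y = trans (sumOf-cong (λ s → PosY.occurs-apart (entry s) y y₀ (y₀≢y ∘ sym)) CY)
                        (pairsY y y₀ (y₀≢y ∘ sym))

  -- Two points on a vertical line {x} × Y: the line {x} × s through them is
  -- either the line at x₀ or produced by a gadget of the block t ∋ x , x₀.
  vertical-pair : ∀ x y y' → y ≢ y' → count (x , y) (x , y') cycle ≡ 1
  vertical-pair x y y' y≢y' = begin
    count P Q cycle ≡⟨ count-cycle P Q ⟩
    sumOf (λ s → count P Q (verticalAt s)) CY + sumOf (λ t → count P Q (horizontalAt t) + sumOf (λ s → count P Q (gadgetAt t s)) CY) CX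
      ≡⟨ cong₂ _+_ verticals (sumOf-congᴬ segment-count CX-distinct) ⟩
    𝟙 (x₀ ≟X x) + sumOf (columnWeight x) CX ≡⟨ columnsThrough x ⟩
    1 ∎
    where
    P Q : X × Y
    P = (x , y)
    Q = (x , y')
    apartY : ∀ s → Apart (posY s y) (posY s y')
    apartY s = PosY.apart-position (entry s) y y' y≢y'
    verticals : sumOf (λ s → count P Q (verticalAt s)) CY ≡ 𝟙 (x₀ ≟X x)
    verticals = begin
      sumOf (λ s → count P Q (verticalAt s)) CY
        ≡⟨ sumOf-congᴬ (λ s ds → trans (count-vertical s ds P Q) (verticalLine-vertical (baseX x) (posY s y) (posY s y') (apartY s))) CY-distinct ⟩
      sumOf (λ s → occurs (baseX x) * (occurs (posY s y) * occurs (posY s y'))) CY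
        ≡⟨ blocksThroughY (occurs (baseX x)) y y' y≢y' ⟩
      occurs (baseX x) ≡⟨ occurs-baseX x ⟩
      𝟙 (x₀ ≟X x) ∎
    segment-count : ∀ t → Distinct t → count P Q (horizontalAt t) + sumOf (λ s → count P Q (gadgetAt t s)) CY ≡ columnWeight x t
    segment-count t dt = cong₂ _+_
      (trans (count-horizontal t dt P Q) (horizontalLine-vertical (posX t x) (baseY y) (baseY y') (PosY.apart-position (single y₀) y y' y≢y')))
      (trans (sumOf-congᴬ (λ s ds → trans (count-gadget t dt s ds P Q) (gadget-vertical (posX t x₀) (posY s y₀) (posX t x) (posY s y) (posY s y') (apartY s))) CY-distinct)
             (blocksThroughY (columnWeight x t) y y' y≢y'))

  -- Two points on a horizontal line X × {y}: only the block t ∋ x , x' can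
  -- contain them, via the line at y₀ or via the row produced by one gadget.
  horizontal-pair : ∀ x x' y → x ≢ x' → count (x , y) (x' , y) cycle ≡ 1
  horizontal-pair x x' y x≢x' = begin
    count P Q cycle ≡⟨ count-cycle P Q ⟩
    sumOf (λ s → count P Q (verticalAt s)) CY + sumOf (λ t → count P Q (horizontalAt t) + sumOf (λ s → count P Q (gadgetAt t s)) CY) CX
      ≡⟨ cong₂ _+_ verticals (sumOf-congᴬ segment-count CX-distinct) ⟩
    sumOf (λ t → occurs (posX t x) * occurs (posX t x')) CX ≡⟨ pairsX x x' x≢x' ⟩
    1 ∎
    where
    P Q : X × Y
    P = (x , y)
    Q = (x' , y)
    apartX : ∀ t → Apart (posX t x) (posX t x')
    apartX t = PosX.apart-position (entry t) x x' x≢x'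
    verticals : sumOf (λ s → count P Q (verticalAt s)) CY ≡ 0
    verticals = sumOf-vanish (λ s ds → trans (count-vertical s ds P Q)
      (verticalLine-horizontal (baseX x) (baseX x') (posY s y) (PosX.apart-position (single x₀) x x' x≢x'))) CY-distinct
    segment-count : ∀ t → Distinct t →
      count P Q (horizontalAt t) + sumOf (λ s → count P Q (gadgetAt t s)) CY ≡ occurs (posX t x) * occurs (posX t x')
    segment-count t dt = begin
      count P Q (horizontalAt t) + sumOf (λ s → count P Q (gadgetAt t s)) CY
        ≡⟨ cong₂ _+_ (trans (count-horizontal t dt P Q) (horizontalLine-horizontal (posX t x) (posX t x') (baseY y) (apartX t)))
                     (sumOf-congᴬ (λ s ds → trans (count-gadget t dt s ds P Q) (gadget-horizontal (posX t x₀) (posY s y₀) (posX t x) (posX t x') (posY s y) (apartX t))) CY-distinct) ⟩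
      a * occurs (baseY y) + sumOf (λ s → a * rowWeight y s) CY
        ≡⟨ cong₂ _+_ (cong (a *_) (occurs-baseY y)) (sumOf-*ˡ a (rowWeight y) CY) ⟩
      a * 𝟙 (y₀ ≟Y y) + a * sumOf (rowWeight y) CY ≡⟨ sym (*-distribˡ-+ a _ _) ⟩
      a * (𝟙 (y₀ ≟Y y) + sumOf (rowWeight y) CY) ≡⟨ cong (a *_) (rowsThrough y) ⟩
      a * 1 ≡⟨ *-identityʳ a ⟩
      a ∎
      where
      a : ℕ
      a = occurs (posX t x) * occurs (posX t x')

  -- Two points with different coordinates: they lie in a transversal of the
  -- gadget of t × s for the unique blocks t ∋ x , x' and s ∋ y , y'.
  diagonal-pair : ∀ x x' y y' → x ≢ x' → y ≢ y' → count (x , y) (x' , y') cycle ≡ 1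
  diagonal-pair x x' y y' x≢x' y≢y' = begin
    count P Q cycle ≡⟨ count-cycle P Q ⟩
    sumOf (λ s → count P Q (verticalAt s)) CY + sumOf (λ t → count P Q (horizontalAt t) + sumOf (λ s → count P Q (gadgetAt t s)) CY) CX
      ≡⟨ cong₂ _+_ verticals (sumOf-congᴬ segment-count CX-distinct) ⟩
    sumOf (λ t → occurs (posX t x) * occurs (posX t x')) CX ≡⟨ pairsX x x' x≢x' ⟩
    1 ∎
    where
    P Q : X × Y
    P = (x , y)
    Q = (x' , y')
    apartX : ∀ t → Apart (posX t x) (posX t x')
    apartX t = PosX.apart-position (entry t) x x' x≢x'
    apartY : ∀ s → Apart (posY s y) (posY s y')
    apartY s = PosY.apart-position (entry s) y y' y≢y'
    verticals : sumOf (λ s → count P Q (verticalAt s)) CY ≡ 0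
    verticals = sumOf-vanish (λ s ds → trans (count-vertical s ds P Q)
      (verticalLine-diagonal (baseX x) (baseX x') (posY s y) (posY s y') (PosX.apart-position (single x₀) x x' x≢x') (apartY s))) CY-distinct
    segment-count : ∀ t → Distinct t →
      count P Q (horizontalAt t) + sumOf (λ s → count P Q (gadgetAt t s)) CY ≡ occurs (posX t x) * occurs (posX t x')
    segment-count t dt = cong₂ _+_
      (trans (count-horizontal t dt P Q) (horizontalLine-diagonal (posX t x) (posX t x') (baseY y) (baseY y') (apartX t) (PosY.apart-position (single y₀) y y' y≢y')))
      (trans (sumOf-congᴬ (λ s ds → trans (count-gadget t dt s ds P Q) (gadget-diagonal (posX t x₀) (posY s y₀) (posX t x) (posX t x') (posY s y) (posY s y') (apartX t) (apartY s))) CY-distinct)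
             (blocksThroughY (occurs (posX t x) * occurs (posX t x')) y y' y≢y'))

  cycle-pairs : ∀ P Q → P ≢ Q → count P Q cycle ≡ 1
  cycle-pairs (x , y) (x' , y') P≢Q with x ≟X x' | y ≟Y y'
  ... | yes refl | yes refl = ⊥-elim (P≢Q refl)
  ... | yes refl | no y≢y' = vertical-pair x y y' y≢y'
  ... | no x≢x' | yes refl = horizontal-pair x x' y x≢x'
  ... | no x≢x' | no y≢y' = diagonal-pair x x' y y' x≢x' y≢y'

∈ₜ⇔∈toSet : ∀ {n} {x : Fin n} (t : Triple n) → (x ∈ₜ t) ⇔ (x ∈ˢ toSet t)
∈ₜ⇔∈toSet {x = x} (a , b , c) = mk⇔ into outof
  where
  into : x ∈ₜ (a , b , c) → x ∈ˢ toSet (a , b , c)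
  into (inj₁ refl) = x∈p∪q⁺ (inj₁ (x∈⁅x⁆ a))
  into (inj₂ (inj₁ refl)) = x∈p∪q⁺ (inj₂ (x∈p∪q⁺ (inj₁ (x∈⁅x⁆ b))))
  into (inj₂ (inj₂ refl)) = x∈p∪q⁺ (inj₂ (x∈p∪q⁺ (inj₂ (x∈⁅x⁆ c))))
  outof : x ∈ˢ toSet (a , b , c) → x ∈ₜ (a , b , c)
  outof m = Sum.map (x∈⁅y⁆⇒x≡y a) (Sum.map (x∈⁅y⁆⇒x≡y b) (x∈⁅y⁆⇒x≡y c) ∘ x∈p∪q⁻ ⁅ b ⁆ ⁅ c ⁆) (x∈p∪q⁻ ⁅ a ⁆ _ m)

countPair-toSet : ∀ {n} (C : List (Triple n)) x y → countPair (map toSet C) x y ≡ pairCount _≟F_ x y C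
countPair-toSet C x y = begin
  countPair (map toSet C) x y                                 ≡⟨ length-filter P? (map toSet C) ⟩
  sumOf (𝟙 ∘ P?) (map toSet C)                                ≡⟨ sumOf-map (𝟙 ∘ P?) toSet C ⟩
  sumOf (𝟙 ∘ P? ∘ toSet) C                                    ≡⟨ sumOf-cong covers-toSet C ⟩
  pairCount _≟F_ x y C                                        ∎
  where
  open ≡-Reasoning
  open DecTri _≟F_ using (_∈ₜ?_)
  P? : ∀ b → Dec (x ∈ˢ b × y ∈ˢ b)
  P? b = (x ∈? b) ×-dec (y ∈? b)
  covers-toSet : ∀ t → 𝟙 (P? (toSet t)) ≡ DecTri.covers _≟F_ x y t
  covers-toSet t = 𝟙-cong (mk⇔ (Product.map (from (∈ₜ⇔∈toSet t)) (from (∈ₜ⇔∈toSet t)))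
                               (Product.map (to (∈ₜ⇔∈toSet t)) (to (∈ₜ⇔∈toSet t))))
                          (P? (toSet t)) ((x ∈ₜ? t) ×-dec (y ∈ₜ? t))

∣⁅x⁆∪p∣-∉ : ∀ {n} (x : Fin n) (p : Subset n) → x ∉ˢ p → ∣ ⁅ x ⁆ ∪ p ∣ ≡ suc ∣ p ∣
∣⁅x⁆∪p∣-∉ zero (outside ∷ p) x∉p rewrite ∪-identityˡ p = refl
∣⁅x⁆∪p∣-∉ zero (inside ∷ p) x∉p = ⊥-elim (x∉p here)
∣⁅x⁆∪p∣-∉ (suc x) (outside ∷ p) x∉p = ∣⁅x⁆∪p∣-∉ x p (x∉p ∘ there)
∣⁅x⁆∪p∣-∉ (suc x) (inside ∷ p) x∉p = cong suc (∣⁅x⁆∪p∣-∉ x p (x∉p ∘ there))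

∣⁅x⁆∪p∣-∈ : ∀ {n} (x : Fin n) (p : Subset n) → x ∈ˢ p → ∣ ⁅ x ⁆ ∪ p ∣ ≡ ∣ p ∣
∣⁅x⁆∪p∣-∈ zero (inside ∷ p) x∈p rewrite ∪-identityˡ p = refl
∣⁅x⁆∪p∣-∈ (suc x) (outside ∷ p) (there x∈p) = ∣⁅x⁆∪p∣-∈ x p x∈p
∣⁅x⁆∪p∣-∈ (suc x) (inside ∷ p) (there x∈p) = cong suc (∣⁅x⁆∪p∣-∈ x p x∈p)

∣⁅x⁆∪p∣≤ : ∀ {n} (x : Fin n) (p : Subset n) → ∣ ⁅ x ⁆ ∪ p ∣ ≤ suc ∣ p ∣
∣⁅x⁆∪p∣≤ x p with x ∈? p
... | yes x∈p = ≤-trans (≤-reflexive (∣⁅x⁆∪p∣-∈ x p x∈p)) (n≤1+n _)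
... | no x∉p = ≤-reflexive (∣⁅x⁆∪p∣-∉ x p x∉p)

∣⁅x⁆∪⁅y⁆∣≤2 : ∀ {n} (x y : Fin n) → ∣ ⁅ x ⁆ ∪ ⁅ y ⁆ ∣ ≤ 2
∣⁅x⁆∪⁅y⁆∣≤2 x y = ≤-trans (∣⁅x⁆∪p∣≤ x ⁅ y ⁆) (s≤s (≤-reflexive (∣⁅x⁆∣≡1 y)))

Distinct⇒IsBlock : ∀ {n} (t : Triple n) → Distinct t → IsBlock (toSet t)
Distinct⇒IsBlock (a , b , c) (a≢b , a≢c , b≢c) =
  trans (∣⁅x⁆∪p∣-∉ a (⁅ b ⁆ ∪ ⁅ c ⁆) ([ a≢b ∘ x∈⁅y⁆⇒x≡y b , a≢c ∘ x∈⁅y⁆⇒x≡y c ] ∘ x∈p∪q⁻ ⁅ b ⁆ ⁅ c ⁆))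
        (cong suc (trans (∣⁅x⁆∪p∣-∉ b ⁅ c ⁆ (b≢c ∘ x∈⁅y⁆⇒x≡y c)) (cong suc (∣⁅x⁆∣≡1 c))))

repeated⇒∣toSet∣≤2 : ∀ {n} (a b c : Fin n) → a ≡ b ⊎ a ≡ c ⊎ b ≡ c → ∣ toSet (a , b , c) ∣ ≤ 2
repeated⇒∣toSet∣≤2 a b c (inj₁ refl) =
  ≤-trans (≤-reflexive (∣⁅x⁆∪p∣-∈ a _ (x∈p∪q⁺ (inj₁ (x∈⁅x⁆ a))))) (∣⁅x⁆∪⁅y⁆∣≤2 a c)
repeated⇒∣toSet∣≤2 a b c (inj₂ (inj₁ refl)) =
  ≤-trans (≤-reflexive (∣⁅x⁆∪p∣-∈ a _ (x∈p∪q⁺ (inj₂ (x∈⁅x⁆ a))))) (∣⁅x⁆∪⁅y⁆∣≤2 b a)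
repeated⇒∣toSet∣≤2 a b c (inj₂ (inj₂ refl)) =
  ≤-trans (∣⁅x⁆∪p∣≤ a _) (s≤s (≤-reflexive (trans (∣⁅x⁆∪p∣-∈ b _ (x∈⁅x⁆ b)) (∣⁅x⁆∣≡1 b))))

IsBlock⇒Distinct : ∀ {n} (t : Triple n) → IsBlock (toSet t) → Distinct t
IsBlock⇒Distinct (a , b , c) block =
  (not-repeated ∘ inj₁) , (not-repeated ∘ inj₂ ∘ inj₁) , (not-repeated ∘ inj₂ ∘ inj₂)
  where
  not-repeated : ¬ (a ≡ b ⊎ a ≡ c ⊎ b ≡ c)
  not-repeated r with subst (_≤ 2) block (repeated⇒∣toSet∣≤2 a b c r)
  ... | s≤s (s≤s ())

countPair-∷-∈ : ∀ {n} b (B : List (Subset n)) {x y} → x ∈ˢ b → y ∈ˢ b → countPair (b ∷ B) x y ≡ suc (countPair B x y)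
countPair-∷-∈ b B {x} {y} x∈b y∈b = cong length (filter-accept (λ b → (x ∈? b) ×-dec (y ∈? b)) (x∈b , y∈b))

countPair-∷ : ∀ {n} b (B : List (Subset n)) x y → countPair B x y ≤ countPair (b ∷ B) x y
countPair-∷ b B x y with (x ∈? b) ×-dec (y ∈? b)
... | yes (x∈b , y∈b) = ≤-trans (n≤1+n _) (≤-reflexive (sym (countPair-∷-∈ b B x∈b y∈b)))
... | no ¬both = ≤-reflexive (sym (cong length (filter-reject (λ b → (x ∈? b) ×-dec (y ∈? b)) ¬both)))

countPair-member : ∀ {n} {b} (B : List (Subset n)) {x y} → b ∈ B → x ∈ˢ b → y ∈ˢ b → 1 ≤ countPair B x y
countPair-member (b ∷ B) (here refl) x∈b y∈b = subst (1 ≤_) (sym (countPair-∷-∈ b B x∈b y∈b)) (s≤s z≤n)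
countPair-member (b' ∷ B) {x} {y} (there m) x∈b y∈b = ≤-trans (countPair-member B m x∈b y∈b) (countPair-∷ b' B x y)

unique-from-pairs : ∀ {n} (B : List (Subset n)) →
  (∀ b → b ∈ B → ∃[ x ] ∃[ y ] x ≢ y × x ∈ˢ b × y ∈ˢ b) →
  (∀ x y → x ≢ y → countPair B x y ≤ 1) → Unique B
unique-from-pairs [] _ _ = []
unique-from-pairs (b ∷ B) two-points at-most-once =
  tabulate differs ∷ unique-from-pairs B (λ b' m → two-points b' (there m))
                                         (λ x y x≢y → ≤-trans (countPair-∷ b B x y) (at-most-once x y x≢y))
  where
  differs : ∀ {b'} → b' ∈ B → b ≢ b'
  differs m refl with two-points b (here refl)
  ... | x , y , x≢y , x∈b , y∈b
    with ≤-trans (s≤s (countPair-member B m x∈b y∈b)) (subst (_≤ 1) (countPair-∷-∈ b B x∈b y∈b) (at-most-once x y x≢y))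
  ... | s≤s ()

Chain⇒CycLinked : ∀ {n} (t : Triple n) ts e → Chain (last t) e ts → CycLinked e (t ∷ ts)
Chain⇒CycLinked t [] e p = p
Chain⇒CycLinked t (u ∷ us) e (h , p) = sym h , Chain⇒CycLinked u us e p

CycLinked⇒Chain : ∀ {n} (t : Triple n) ts e → CycLinked e (t ∷ ts) → Chain (last t) e ts
CycLinked⇒Chain t [] e p = p
CycLinked⇒Chain t (u ∷ us) e (h , p) = sym h , CycLinked⇒Chain u us e p

sts-from-cycle : ∀ {n} (C : List (Triple n)) h → Chain h h C → All Distinct C →
  (∀ x y → x ≢ y → pairCount _≟F_ x y C ≡ 1) → HasSTSWithOCycle n
sts-from-cycle {n} C h chain distinct pairs = B , (unique , blocks , counts) , C , ocycle C chain
  where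
  B : List (Subset n)
  B = map toSet C
  counts : ∀ x y → x ≢ y → countPair B x y ≡ 1
  counts x y x≢y = trans (countPair-toSet C x y) (pairs x y x≢y)
  blocks : ∀ b → b ∈ B → IsBlock b
  blocks b m with ∈-map⁻ toSet m
  ... | t , t∈C , refl = Distinct⇒IsBlock t (lookup distinct t∈C)
  two-points : ∀ b → b ∈ B → ∃[ x ] ∃[ y ] x ≢ y × x ∈ˢ b × y ∈ˢ b
  two-points b m with ∈-map⁻ toSet m
  ... | (a , a' , c) , t∈C , refl =
    a , a' , proj₁ (lookup distinct t∈C) , to (∈ₜ⇔∈toSet (a , a' , c)) (inj₁ refl) , to (∈ₜ⇔∈toSet (a , a' , c)) (inj₂ (inj₁ refl))
  unique : Unique B
  unique = unique-from-pairs B two-points (λ x y x≢y → ≤-reflexive (counts x y x≢y))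
  ocycle : ∀ C → Chain h h C → IsOneOCycle (map toSet C) C
  ocycle [] _ = refl
  ocycle (t ∷ ts) (first≡h , rest) = ↭-refl , subst (λ z → CycLinked z (t ∷ ts)) (sym first≡h) (Chain⇒CycLinked t ts h rest)

module CycleOfSTS {n} (B : List (Subset n)) (sts : IsSTS n B) (C : List (Triple n)) (perm : map toSet C ↭ B) where

  cycle-distinct : All Distinct C
  cycle-distinct = tabulate (λ {t} t∈C → IsBlock⇒Distinct t (proj₁ (proj₂ sts) (toSet t) (∈-resp-↭ perm (∈-map⁺ toSet t∈C))))

  cycle-pairs : ∀ x y → x ≢ y → pairCount _≟F_ x y C ≡ 1
  cycle-pairs x y x≢y = begin
    pairCount _≟F_ x y C         ≡⟨ sym (countPair-toSet C x y) ⟩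
    countPair (map toSet C) x y  ≡⟨ ↭-length (filter-↭ (λ b → (x ∈? b) ×-dec (y ∈? b)) perm) ⟩
    countPair B x y              ≡⟨ proj₂ (proj₂ sts) x y x≢y ⟩
    1 ∎
    where open ≡-Reasoning

encode : ∀ {u v} → Fin u × Fin v → Fin (u * v)
encode (i , j) = combine i j

encode-injective : ∀ {u v} → Inj (encode {u} {v})
encode-injective {x = i , j} {y = k , l} e = cong₂ _,_ (combine-injectiveˡ i j k l e) (combine-injectiveʳ i j k l e)

product : ∀ {u v} (BX : List (Subset u)) (BY : List (Subset v)) → IsSTS u BX → IsSTS v BY →
  ∀ tX tsX tY tsY → IsOneOCycle BX (tX ∷ tsX) → IsOneOCycle BY (tY ∷ tsY) → HasSTSWithOCycle (u * v)
product {u} {v} BX BY stsX stsY tX tsX tY tsY (permX , linkedX) (permY , linkedY) =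
  sts-from-cycle (map (mapTri encode) cycle) (encode (first tX , first tY))
    (Chain-map encode cycle cycle-chain)
    (All.map⁺ (All.map (λ {T} → Distinct-map encode encode-injective T) cycle-distinct))
    encoded-pairs
  where
  module X = CycleOfSTS BX stsX (tX ∷ tsX) permX
  module Y = CycleOfSTS BY stsY (tY ∷ tsY) permY
  open ProductCycle _≟F_ _≟F_ (tX ∷ tsX) (tY ∷ tsY) (first tX) (first tY)
    X.cycle-distinct Y.cycle-distinct X.cycle-pairs Y.cycle-pairs
    (refl , CycLinked⇒Chain tX tsX _ linkedX) (refl , CycLinked⇒Chain tY tsY _ linkedY)
  decode : Fin (u * v) → Fin u × Fin v
  decode = remQuot v
  encode-decode : ∀ x → encode (decode x) ≡ x
  encode-decode = combine-remQuot {u} v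
  encoded-pairs : ∀ x y → x ≢ y → pairCount _≟F_ x y (map (mapTri encode) cycle) ≡ 1
  encoded-pairs x y x≢y = begin
    pairCount _≟F_ x y (map (mapTri encode) cycle)
      ≡⟨ cong₂ (λ a b → pairCount _≟F_ a b (map (mapTri encode) cycle)) (sym (encode-decode x)) (sym (encode-decode y)) ⟩
    pairCount _≟F_ (encode (decode x)) (encode (decode y)) (map (mapTri encode) cycle)
      ≡⟨ pairCount-injective (≡-dec× _≟F_ _≟F_) _≟F_ encode encode-injective (decode x) (decode y) cycle ⟩
    count (decode x) (decode y) cycle
      ≡⟨ cycle-pairs (decode x) (decode y) (λ e → x≢y (trans (sym (encode-decode x)) (trans (cong encode e) (encode-decode y)))) ⟩
    1 ∎
    where open ≡-Reasoning

no-blocks⇒trivial : ∀ n B → IsSTS n B → B ≡ [] → n ≡ 0 ⊎ n ≡ 1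
no-blocks⇒trivial zero B _ _ = inj₁ refl
no-blocks⇒trivial (suc zero) B _ _ = inj₂ refl
no-blocks⇒trivial (suc (suc n)) .[] (_ , _ , pairs) refl with pairs zero (suc zero) (λ ())
... | ()

sts₀ : HasSTSWithOCycle 0
sts₀ = [] , ([] , (λ b ()) , (λ ())) , [] , refl

-- Theorem 6: for nonempty cycles take the product; an empty cycle forces
-- order 0 or 1, where u * v is 0 or v.
mainTheorem6 : (u v : ℕ) → HasSTSWithOCycle u → HasSTSWithOCycle v → HasSTSWithOCycle (u * v)
mainTheorem6 u v (BX , stsX , tX ∷ tsX , cycX) (BY , stsY , tY ∷ tsY , cycY) =
  product BX BY stsX stsY tX tsX tY tsY cycX cycY
mainTheorem6 u v (BX , stsX , [] , noBlocks) hv with no-blocks⇒trivial u BX stsX noBlocks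
... | inj₁ refl = sts₀
... | inj₂ refl = subst HasSTSWithOCycle (sym (+-identityʳ v)) hv
mainTheorem6 u v hu@(_ , _ , _ ∷ _ , _) (BY , stsY , [] , noBlocks) with no-blocks⇒trivial v BY stsY noBlocks
... | inj₁ refl = subst HasSTSWithOCycle (sym (*-zeroʳ u)) sts₀
... | inj₂ refl = subst HasSTSWithOCycle (sym (*-identityʳ u)) hu
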